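{- For every $n\ge 1$, the map $\rho$ is a bijection from the set of compositions of $n$ onto $\mathcal{RS}_n(312)$.
   Context: For $\sigma\in\mathfrak{S}_n$, a double descent is an index $i$ with $\sigma_i>\sigma_{i+1}>\sigma_{i+2}$. The permutation $\sigma$ is simsun if for every $k$, the subword of $\sigma$ consisting of the letters in $\{1,\dots,k\}$ (in the order they appear in $\sigma$) has no double descent. $\mathcal{RS}_n(312)$ is the set of simsun permutations in $\mathfrak{S}_n$ containing no indices $i_1<i_2<i_3$ with $\sigma_{i_2}<\sigma_{i_3}<\sigma_{i_1}$. For a composition $C=(t_1,\dots,t_j)$ of $n$ (ordered sequence of positive integers summing to $n$), let $s_0=0$ and $s_i=t_1+\cdots+t_i$. Split $12\cdots n$ into blocks $\mu_i=(s_{i-1}+1)(s_{i-1}+2)\cdots s_i$, and let $\widehat{\mu}_i=(s_{i-1}+2)\cdots s_i\,(s_{i-1}+1)$ be $\mu_i$ with its first letter moved to the end. Define $\rho(C)=\widehat{\mu}_1\widehat{\mu}_2\cdots\widehat{\mu}_j\in\mathfrak{S}_n$ (concatenation). E.g. $\rho(3,2,1,3)=231546897$. -}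

module Defs where

open import Data.Nat using (ℕ; zero; suc; _+_; _<_; _≤_; _>_; _≤?_)
open import Data.List using (List; []; _∷_; _++_; map; upTo; length; lookup; filter; [_])
open import Data.Nat.ListAction using (sum)
open import Data.List.Relation.Unary.All using (All)
open import Data.List.Relation.Binary.Permutation.Propositional using (_↭_)
open import Data.Fin using (Fin) renaming (_<_ to _<ᶠ_)
open import Data.Product using (_×_; Σ; ∃; ∃-syntax)
open import Relation.Binary.PropositionalEquality using (_≡_)
open import Relation.Nullary using (¬_)

oneToN : ℕ → List ℕ
oneToN n = map suc (upTo n)

IsPerm : ℕ → List ℕ → Set
IsPerm n σ = σ ↭ oneToN n

IsComposition : ℕ → List ℕ → Set
IsComposition n c = All (λ t → 1 ≤ t) c × sum c ≡ n

data HasDoubleDescent : List ℕ → Set where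
  here  : ∀ {a b c rest} → a > b → b > c → HasDoubleDescent (a ∷ b ∷ c ∷ rest)
  there : ∀ {a rest} → HasDoubleDescent rest → HasDoubleDescent (a ∷ rest)

restrict : ℕ → List ℕ → List ℕ
restrict k σ = filter (_≤? k) σ

IsSimsun : List ℕ → Set
IsSimsun σ = ∀ k → ¬ HasDoubleDescent (restrict k σ)

Contains312 : List ℕ → Set
Contains312 σ = ∃[ i₁ ] ∃[ i₂ ] ∃[ i₃ ]
  (i₁ <ᶠ i₂ × i₂ <ᶠ i₃ × lookup σ i₂ < lookup σ i₃ × lookup σ i₃ < lookup σ i₁)

RS312 : ℕ → List ℕ → Set
RS312 n σ = IsPerm n σ × IsSimsun σ × ¬ Contains312 σ

-- block μ with offset s and length t, first letter moved to the end:
-- (s+2)(s+3)...(s+t)(s+1)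
hatBlock : ℕ → ℕ → List ℕ
hatBlock s zero    = []
hatBlock s (suc t) = map (λ i → s + suc (suc i)) (upTo t) ++ [ s + 1 ]

rhoFrom : ℕ → List ℕ → List ℕ
rhoFrom s []       = []
rhoFrom s (t ∷ ts) = hatBlock s t ++ rhoFrom (s + t) ts

rho : List ℕ → List ℕ
rho c = rhoFrom 0 c

module Submission where

-- Write  run a q  for the increasing run  a (a+1) … (a+q-1).  With offset s,
-- ρ of a part t = q+1 followed by ts is  run (s+2) q ++ (s+1) ∷ ρ_{s+t} ts :
-- every block is a run followed by one letter that is smaller than the run
-- and than everything after it.  From this normal form we get, in order:
--   * ρ_s c is a rearrangement of run (s+1) (sum c), so ρ c is a permutation;
--   * "block words" are closed under restriction to the letters ≤ k and have
--     no double descent, so ρ c is simsun;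
--   * via an inductive description of 312 occurrences: no occurrence lies in
--     one block or straddles two, so ρ c avoids 312;
--   * the first block of ρ_s c determines the first part, hence injectivity.
-- Surjectivity reads σ from left to right.  While a block with smallest letter
-- p is open and the letters still to come are p and m+1, m+2, …, the next
-- letter is p (closing the block) or m+1 (extending the run): a larger head h
-- would be followed by p < m+1 < h, producing a 312 pattern or a double
-- descent in the restriction of σ to the letters ≤ h.

open import Defs
open import Data.Nat using (ℕ; _≥_)
open import Data.List using (List)
open import Data.Product using (_×_; ∃-syntax)
open import Relation.Binary.PropositionalEquality using (_≡_)

open import Data.Nat using (zero; suc; _+_; _<_; _≤_; _≤?_; z≤n; s≤s; _≟_)
open import Data.Nat.Properties
open import Data.Nat.ListAction using (sum)
open import Data.List using ([]; _∷_; _++_; applyUpTo; length; lookup; [_])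
open import Data.List.Properties
  using (map-upTo; filter-accept; filter-reject; filter-none; filter-++; ++-assoc; ∷-injectiveˡ; ∷-injectiveʳ)
open import Data.List.Relation.Unary.All using (All; []; _∷_)
import Data.List.Relation.Unary.All as All
import Data.List.Relation.Unary.All.Properties as All
open import Data.List.Relation.Unary.Any using (Any; here; there)
import Data.List.Relation.Unary.Any.Properties as Any
open import Data.List.Membership.Propositional using (_∈_)
open import Data.List.Membership.Propositional.Properties using (∈-filter⁺)
open import Data.List.Relation.Unary.Unique.Propositional using (Unique; []; _∷_)
import Data.List.Relation.Unary.Unique.Propositional.Properties as Unique
import Data.List.Relation.Binary.Permutation.Setoid.Properties as PermSetoid
open import Data.List.Relation.Binary.Permutation.Propositional
  using (_↭_; prep; swap; ↭-sym; ↭-refl; ↭-trans; ↭⇒↭ₛ)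
open import Data.List.Relation.Binary.Permutation.Propositional.Properties
  using (↭-empty-inv; ¬x∷xs↭[]; drop-∷; ∈-resp-↭; shift; ++⁺ˡ)
open import Data.Fin using (Fin; zero; suc; toℕ)
open import Data.Product using (Σ; _,_)
open import Data.Sum using (_⊎_; inj₁; inj₂)
open import Data.Empty using (⊥; ⊥-elim)
open import Relation.Nullary using (¬_; yes; no)
open import Relation.Binary.PropositionalEquality using (_≢_; refl; sym; trans; cong; cong₂; subst; setoid; module ≡-Reasoning)
open import Relation.Binary.Definitions using (tri<; tri≈; tri>)

run : ℕ → ℕ → List ℕ
run a zero    = []
run a (suc q) = a ∷ run (suc a) q

applyUpTo-run : ∀ (f : ℕ → ℕ) a q → (∀ i → f i ≡ a + i) → applyUpTo f q ≡ run a q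
applyUpTo-run f a zero    _ = refl
applyUpTo-run f a (suc q) f≗ =
  cong₂ _∷_ (trans (f≗ 0) (+-identityʳ a))
            (applyUpTo-run (λ i → f (suc i)) (suc a) q (λ i → trans (f≗ (suc i)) (+-suc a i)))

oneToN-run : ∀ n → oneToN n ≡ run 1 n
oneToN-run n = trans (map-upTo suc n) (applyUpTo-run suc 1 n (λ _ → refl))

run-++ : ∀ a x y → run a (x + y) ≡ run a x ++ run (a + x) y
run-++ a zero    y = cong (λ b → run b y) (sym (+-identityʳ a))
run-++ a (suc x) y = cong (a ∷_) (begin
  run (suc a) (x + y)              ≡⟨ run-++ (suc a) x y ⟩
  run (suc a) x ++ run (suc a + x) y ≡⟨ cong (λ b → run (suc a) x ++ run b y) (sym (+-suc a x)) ⟩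
  run (suc a) x ++ run (a + suc x) y ∎)
  where open ≡-Reasoning

run-lower : ∀ {x} a n → x ∈ run a n → a ≤ x
run-lower a (suc n) (here refl) = ≤-refl
run-lower a (suc n) (there x∈) = <⇒≤ (run-lower (suc a) n x∈)

all-run : ∀ {P : ℕ → Set} a q → (∀ y → a ≤ y → y < a + q → P y) → All P (run a q)
all-run a zero    _ = []
all-run a (suc q) P-range =
  P-range a ≤-refl (subst (a <_) (sym (+-suc a q)) (s≤s (m≤m+n a q)))
  ∷ all-run (suc a) q (λ y a<y y<end → P-range y (<⇒≤ a<y) (subst (y <_) (sym (+-suc a q)) y<end))

hatBlock-run : ∀ s q → hatBlock s (suc q) ≡ run (suc (suc s)) q ++ [ suc s ]
hatBlock-run s q = cong₂ _++_
  (trans (map-upTo _ q) (applyUpTo-run _ _ q (λ i → trans (+-suc s (suc i)) (cong suc (+-suc s i)))))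
  (cong [_] (+-comm s 1))

rhoFrom-suc : ∀ s q ts → rhoFrom s (suc q ∷ ts) ≡ run (suc (suc s)) q ++ suc s ∷ rhoFrom (suc s + q) ts
rhoFrom-suc s q ts = begin
  hatBlock s (suc q) ++ rhoFrom (s + suc q) ts
    ≡⟨ cong (_++ rhoFrom (s + suc q) ts) (hatBlock-run s q) ⟩
  (run (suc (suc s)) q ++ [ suc s ]) ++ rhoFrom (s + suc q) ts
    ≡⟨ ++-assoc (run (suc (suc s)) q) [ suc s ] _ ⟩
  run (suc (suc s)) q ++ suc s ∷ rhoFrom (s + suc q) ts
    ≡⟨ cong (λ b → run (suc (suc s)) q ++ suc s ∷ rhoFrom b ts) (+-suc s q) ⟩
  run (suc (suc s)) q ++ suc s ∷ rhoFrom (suc s + q) ts ∎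
  where open ≡-Reasoning

-- A zero part contributes nothing; the structural lemmas below therefore hold
-- for arbitrary lists of naturals, not only compositions.
rhoFrom-zero : ∀ s ts → rhoFrom s (0 ∷ ts) ≡ rhoFrom s ts
rhoFrom-zero s ts = cong (λ b → rhoFrom b ts) (+-identityʳ s)

rhoFrom-↭ : ∀ s c → rhoFrom s c ↭ run (suc s) (sum c)
rhoFrom-↭ s [] = ↭-refl
rhoFrom-↭ s (zero ∷ ts) rewrite rhoFrom-zero s ts = rhoFrom-↭ s ts
rhoFrom-↭ s (suc q ∷ ts) rewrite rhoFrom-suc s q ts | run-++ (suc (suc s)) q (sum ts) =
  ↭-trans (shift (suc s) (run (suc (suc s)) q) (rhoFrom (suc s + q) ts))
          (prep (suc s) (++⁺ˡ (run (suc (suc s)) q) (rhoFrom-↭ (suc s + q) ts)))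

unique-run : ∀ a n → Unique (run a n)
unique-run a zero    = []
unique-run a (suc n) = all-run (suc a) n (λ y a<y _ a≡y → <-irrefl a≡y a<y) ∷ unique-run (suc a) n

perm-unique : ∀ n σ → IsPerm n σ → Unique σ
perm-unique n σ σ↭ = PermSetoid.Unique-resp-↭ (setoid ℕ) (↭⇒↭ₛ (↭-sym σ↭))
  (subst Unique (sym (oneToN-run n)) (unique-run 1 n))

rhoFrom-above : ∀ s c → All (s <_) (rhoFrom s c)
rhoFrom-above s [] = []
rhoFrom-above s (zero ∷ ts) rewrite rhoFrom-zero s ts = rhoFrom-above s ts
rhoFrom-above s (suc q ∷ ts) rewrite rhoFrom-suc s q ts =
  All.++⁺ (all-run (suc (suc s)) q (λ y s+1<y _ → <-trans (n<1+n s) s+1<y))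
          (n<1+n s ∷ All.map (<-trans (s≤s (m≤m+n s q))) (rhoFrom-above (suc s + q) ts))

data BlockWord : List ℕ → Set where
  []  : BlockWord []
  blk : ∀ {m q p rest} → p < m → All (p <_) rest → BlockWord rest → BlockWord (run m q ++ p ∷ rest)

rhoFrom-blockWord : ∀ s c → BlockWord (rhoFrom s c)
rhoFrom-blockWord s [] = []
rhoFrom-blockWord s (zero ∷ ts) rewrite rhoFrom-zero s ts = rhoFrom-blockWord s ts
rhoFrom-blockWord s (suc q ∷ ts) rewrite rhoFrom-suc s q ts =
  blk (n<1+n (suc s)) (All.map (≤-<-trans (s≤s (m≤m+n s q))) (rhoFrom-above (suc s + q) ts))
      (rhoFrom-blockWord (suc s + q) ts)

restrict-cases : ∀ k x xs (C : List ℕ → Set) →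
  (x ≤ k → C (x ∷ restrict k xs)) → (¬ x ≤ k → C (restrict k xs)) → C (restrict k (x ∷ xs))
restrict-cases k x xs C kept dropped with x ≤? k
... | yes x≤k = subst C (sym (filter-accept (_≤? k) x≤k)) (kept x≤k)
... | no  x≰k = subst C (sym (filter-reject (_≤? k) x≰k)) (dropped x≰k)

restrict-all : ∀ {P : ℕ → Set} k xs → All P xs → All P (restrict k xs)
restrict-all k [] [] = []
restrict-all {P} k (x ∷ xs) (px ∷ pxs) =
  restrict-cases k x xs (All P) (λ _ → px ∷ restrict-all k xs pxs) (λ _ → restrict-all k xs pxs)

restrict-run : ∀ k m q → ∃[ q′ ] restrict k (run m q) ≡ run m q′
restrict-run k m zero    = 0 , refl
restrict-run k m (suc q) = restrict-cases k m (run (suc m) q) (λ w → ∃[ q′ ] w ≡ run m q′)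
  (λ _ → let (q′ , eq) = restrict-run k (suc m) q in suc q′ , cong (m ∷_) eq)
  (λ m≰k → 0 , filter-none (_≤? k)
     (all-run (suc m) q (λ y m<y _ y≤k → m≰k (≤-trans (<⇒≤ m<y) y≤k))))

-- If a block's closing letter is dropped, so is the whole block word from there on.
restrict-blockWord : ∀ k {w} → BlockWord w → BlockWord (restrict k w)
restrict-blockWord k [] = []
restrict-blockWord k (blk {m} {q} {p} {rest} p<m p<rest bw) with p ≤? k
... | yes p≤k rewrite filter-++ (_≤? k) (run m q) (p ∷ rest) | filter-accept (_≤? k) {p} {rest} p≤k
  with restrict-run k m q
...   | q′ , eq rewrite eq = blk p<m (restrict-all k rest p<rest) (restrict-blockWord k bw)
restrict-blockWord k (blk {m} {q} {p} {rest} p<m p<rest bw) | no p≰k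
  rewrite filter-none (_≤? k) {run m q ++ p ∷ rest}
    (All.++⁺ (all-run m q (λ y m≤y _ y≤k → p≰k (≤-trans (<⇒≤ (<-≤-trans p<m m≤y)) y≤k)))
             (p≰k ∷ All.map (λ p<y y≤k → p≰k (≤-trans (<⇒≤ p<y) y≤k)) p<rest)) = []

doubleDescent-after-ascent : ∀ {a b r} → a < b → HasDoubleDescent (a ∷ b ∷ r) → HasDoubleDescent (b ∷ r)
doubleDescent-after-ascent a<b (here a>b _) = ⊥-elim (<-asym a<b a>b)
doubleDescent-after-ascent a<b (there dd)   = dd

-- Within a block only the closing letter descends, and then the word ascends.
block-noDoubleDescent : ∀ m q p rest → p < m → All (p <_) rest →
  ¬ HasDoubleDescent rest → ¬ HasDoubleDescent (run m q ++ p ∷ rest)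
block-noDoubleDescent m zero p (b ∷ _) _ (p<b ∷ _) _ (here p>b _) = <-asym p>b p<b
block-noDoubleDescent m zero p rest _ _ noDD (there dd) = noDD dd
block-noDoubleDescent m (suc zero) p (c ∷ _) _ (p<c ∷ _) _ (here _ p>c) = <-asym p>c p<c
block-noDoubleDescent m (suc zero) p rest p<m p<rest noDD (there dd) =
  block-noDoubleDescent m zero p rest p<m p<rest noDD dd
block-noDoubleDescent m (suc (suc q)) p rest p<m p<rest noDD dd =
  block-noDoubleDescent (suc m) (suc q) p rest (<-trans p<m (n<1+n m)) p<rest noDD
    (doubleDescent-after-ascent (n<1+n m) dd)

blockWord-noDoubleDescent : ∀ {w} → BlockWord w → ¬ HasDoubleDescent w
blockWord-noDoubleDescent [] ()
blockWord-noDoubleDescent (blk {m} {q} {p} {rest} p<m p<rest bw) =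
  block-noDoubleDescent m q p rest p<m p<rest (blockWord-noDoubleDescent bw)

rho-simsun : ∀ c → IsSimsun (rho c)
rho-simsun c k = blockWord-noDoubleDescent (restrict-blockWord k (rhoFrom-blockWord 0 c))

data Below12 (a : ℕ) : List ℕ → Set where
  here  : ∀ {b rest} → b < a → Any (λ c → b < c × c < a) rest → Below12 a (b ∷ rest)
  there : ∀ {x rest} → Below12 a rest → Below12 a (x ∷ rest)

data Has312 : List ℕ → Set where
  here  : ∀ {a rest} → Below12 a rest → Has312 (a ∷ rest)
  there : ∀ {x rest} → Has312 rest → Has312 (x ∷ rest)

any-lookup : ∀ {P : ℕ → Set} (t : List ℕ) (j : Fin (length t)) → P (lookup t j) → Any P t
any-lookup (x ∷ t) zero    px = here px
any-lookup (x ∷ t) (suc j) pt = there (any-lookup t j pt)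

lookup-any : ∀ {P : ℕ → Set} {t : List ℕ} → Any P t → Σ (Fin (length t)) λ j → P (lookup t j)
lookup-any (here px) = zero , px
lookup-any (there pt) = let (j , pj) = lookup-any pt in suc j , pj

positions⇒below12 : ∀ a (t : List ℕ) (j k : Fin (length t)) → toℕ j < toℕ k →
  lookup t j < lookup t k → lookup t k < a → Below12 a t
positions⇒below12 a (y ∷ t) zero    (suc k) _ y<tk tk<a = here (<-trans y<tk tk<a) (any-lookup t k (y<tk , tk<a))
positions⇒below12 a (y ∷ t) (suc j) (suc k) (s≤s j<k) tj<tk tk<a = there (positions⇒below12 a t j k j<k tj<tk tk<a)

contains312⇒has312 : ∀ σ → Contains312 σ → Has312 σ
contains312⇒has312 (x ∷ t) (zero , suc j , suc k , _ , s≤s j<k , tj<tk , tk<x) =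
  here (positions⇒below12 x t j k j<k tj<tk tk<x)
contains312⇒has312 (x ∷ t) (suc i , suc j , suc k , s≤s i<j , s≤s j<k , tj<tk , tk<ti) =
  there (contains312⇒has312 t (i , j , k , i<j , j<k , tj<tk , tk<ti))

below12⇒positions : ∀ {a t} → Below12 a t → Σ (Fin (length t)) λ j → Σ (Fin (length t)) λ k →
  toℕ j < toℕ k × lookup t j < lookup t k × lookup t k < a
below12⇒positions (here _ later) = let (k , b<c , c<a) = lookup-any later in zero , suc k , s≤s z≤n , b<c , c<a
below12⇒positions (there b12) =
  let (j , k , j<k , tj<tk , tk<a) = below12⇒positions b12 in suc j , suc k , s≤s j<k , tj<tk , tk<a

below12⇒contains312 : ∀ {a t} → Below12 a t → Contains312 (a ∷ t)
below12⇒contains312 b12 =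
  let (j , k , j<k , tj<tk , tk<a) = below12⇒positions b12 in zero , suc j , suc k , s≤s z≤n , s≤s j<k , tj<tk , tk<a

contains312-∷ : ∀ {x t} → Contains312 t → Contains312 (x ∷ t)
contains312-∷ (i , j , k , i<j , j<k , tj<tk , tk<ti) = suc i , suc j , suc k , s≤s i<j , s≤s j<k , tj<tk , tk<ti

above-noBelow12 : ∀ {a B} → All (a <_) B → ¬ Below12 a B
above-noBelow12 (a<b ∷ _) (here b<a _) = <-asym a<b b<a
above-noBelow12 (_ ∷ a<B) (there b12) = above-noBelow12 a<B b12

above-noneBelow : ∀ {a : ℕ} {P : ℕ → Set} {B} → All (a <_) B → ¬ Any (λ c → P c × c < a) B
above-noneBelow (a<c ∷ _) (here (_ , c<a)) = <-asym a<c c<a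
above-noneBelow (_ ∷ a<B) (there inB) = above-noneBelow a<B inB

below12-++ : ∀ {a B} A → All (a <_) B → Below12 a (A ++ B) → Below12 a A
below12-++ [] a<B b12 = ⊥-elim (above-noBelow12 a<B b12)
below12-++ (x ∷ A) a<B (here x<a later) with Any.++⁻ A later
... | inj₁ inA = here x<a inA
... | inj₂ inB = ⊥-elim (above-noneBelow a<B inB)
below12-++ (x ∷ A) a<B (there b12) = there (below12-++ A a<B b12)

has312-++ : ∀ {B} A → All (λ x → All (x <_) B) A → Has312 (A ++ B) → Has312 A ⊎ Has312 B
has312-++ [] _ h = inj₂ h
has312-++ (x ∷ A) (x<B ∷ _) (here b12) = inj₁ (here (below12-++ A x<B b12))
has312-++ (x ∷ A) (_ ∷ A<B) (there h) with has312-++ A A<B h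
... | inj₁ inA = inj₁ (there inA)
... | inj₂ inB = inj₂ inB

-- Inside a run everything to the right of a letter is above it.
run-noBelow12 : ∀ a m q p → a < m → ¬ Below12 a (run m q ++ [ p ])
run-noBelow12 a m zero    p _ (here _ ())
run-noBelow12 a m zero    p _ (there ())
run-noBelow12 a m (suc q) p a<m (here m<a _) = <-asym a<m m<a
run-noBelow12 a m (suc q) p a<m (there b12) = run-noBelow12 a (suc m) q p (<-trans a<m (n<1+n m)) b12

block-no312 : ∀ m q p → p < m → ¬ Has312 (run m q ++ [ p ])
block-no312 m zero    p _ (here ())
block-no312 m zero    p _ (there ())
block-no312 m (suc q) p _ (here b12) = run-noBelow12 m (suc m) q p (n<1+n m) b12
block-no312 m (suc q) p p<m (there h) = block-no312 (suc m) q p (<-trans p<m (n<1+n m)) h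

-- The blocks of ρ_s c increase from left to right, so 312 splits by has312-++.
rhoFrom-no312 : ∀ s c → ¬ Has312 (rhoFrom s c)
rhoFrom-no312 s [] ()
rhoFrom-no312 s (zero ∷ ts) rewrite rhoFrom-zero s ts = rhoFrom-no312 s ts
rhoFrom-no312 s (suc q ∷ ts) h rewrite rhoFrom-suc s q ts
  with has312-++ {rhoFrom (suc s + q) ts} (run (suc (suc s)) q ++ [ suc s ]) first<rest
         (subst Has312 (sym (++-assoc (run (suc (suc s)) q) [ suc s ] (rhoFrom (suc s + q) ts))) h)
  where
  rest-above : All (suc s + q <_) (rhoFrom (suc s + q) ts)
  rest-above = rhoFrom-above (suc s + q) ts
  first<rest : All (λ x → All (x <_) (rhoFrom (suc s + q) ts)) (run (suc (suc s)) q ++ [ suc s ])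
  first<rest = All.++⁺
    (all-run (suc (suc s)) q (λ { y _ (s≤s y≤s+q) → All.map (≤-<-trans y≤s+q) rest-above }))
    (All.map (≤-<-trans (s≤s (m≤m+n s q))) rest-above ∷ [])
... | inj₁ inFirst = block-no312 (suc (suc s)) q (suc s) (n<1+n (suc s)) inFirst
... | inj₂ inRest  = rhoFrom-no312 (suc s + q) ts inRest

nonempty-block : ∀ a q x r → run a q ++ x ∷ r ≢ []
nonempty-block a zero    x r ()
nonempty-block a (suc q) x r ()

-- The closing letter p < m ends the run, so a block and what follows are determined.
block-injective : ∀ m q q′ p r r′ → p < m → run m q ++ p ∷ r ≡ run m q′ ++ p ∷ r′ → q ≡ q′ × r ≡ r′
block-injective m zero    zero     p r r′ _ refl = refl , refl
block-injective m zero    (suc q′) p r r′ p<m eq = ⊥-elim (<-irrefl (∷-injectiveˡ eq) p<m)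
block-injective m (suc q) zero     p r r′ p<m eq = ⊥-elim (<-irrefl (sym (∷-injectiveˡ eq)) p<m)
block-injective m (suc q) (suc q′) p r r′ p<m eq =
  let (q≡q′ , r≡r′) = block-injective (suc m) q q′ p r r′ (<-trans p<m (n<1+n m)) (∷-injectiveʳ eq)
  in cong suc q≡q′ , r≡r′

-- Positive parts make every block nonempty, so ρ_s peels off one part at a time.
rhoFrom-injective : ∀ s c c′ → All (1 ≤_) c → All (1 ≤_) c′ → rhoFrom s c ≡ rhoFrom s c′ → c ≡ c′
rhoFrom-injective s [] [] _ _ _ = refl
rhoFrom-injective s [] (zero ∷ _) _ (() ∷ _) _
rhoFrom-injective s (zero ∷ _) _ (() ∷ _) _ _
rhoFrom-injective s [] (suc q′ ∷ ts′) _ _ eq = ⊥-elim (nonempty-block _ q′ _ _ (sym (trans eq (rhoFrom-suc s q′ ts′))))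
rhoFrom-injective s (suc q ∷ ts) [] _ _ eq = ⊥-elim (nonempty-block _ q _ _ (trans (sym (rhoFrom-suc s q ts)) eq))
rhoFrom-injective s (suc q ∷ ts) (suc q′ ∷ ts′) (_ ∷ pos) (_ ∷ pos′) eq
  with block-injective (suc (suc s)) q q′ (suc s) _ _ (n<1+n (suc s))
         (trans (sym (rhoFrom-suc s q ts)) (trans eq (rhoFrom-suc s q′ ts′)))
... | refl , eqRest = cong (suc q ∷_) (rhoFrom-injective (suc s + q) ts ts′ pos pos′ eqRest)

simsun-tail : ∀ {x t} → IsSimsun (x ∷ t) → IsSimsun t
simsun-tail {x} {t} simsun k dd = simsun k (restrict-cases k x t HasDoubleDescent (λ _ → there dd) (λ _ → dd))

any-restrict : ∀ {P : ℕ → Set} k t → Any P (restrict k t) → Any P t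
any-restrict k [] ()
any-restrict {P} k (x ∷ t) = restrict-cases k x t (λ w → Any P w → Any P (x ∷ t))
  (λ _ → λ { (here px) → here px ; (there pt) → there (any-restrict k t pt) })
  (λ _ pt → there (any-restrict k t pt))

below12-restrict : ∀ a k t → Below12 a (restrict k t) → Below12 a t
below12-restrict a k [] ()
below12-restrict a k (x ∷ t) = restrict-cases k x t (λ w → Below12 a w → Below12 a (x ∷ t))
  (λ _ → λ { (here x<a later) → here x<a (any-restrict k t later)
           ; (there b12) → there (below12-restrict a k t b12) })
  (λ _ b12 → there (below12-restrict a k t b12))

restrict-below : ∀ h t → All (h ≢_) t → All (_< h) (restrict h t)
restrict-below h [] [] = []
restrict-below h (x ∷ t) (h≢x ∷ h∉t) = restrict-cases h x t (All (_< h))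
  (λ x≤h → ≤∧≢⇒< x≤h (λ x≡h → h≢x (sym x≡h)) ∷ restrict-below h t h∉t)
  (λ _ → restrict-below h t h∉t)

-- Two distinct letters below h following h: the first two letters of u
-- either ascend (a 12 below h) or descend (a double descent from h).
two-below : ∀ h u x y → x ∈ u → y ∈ u → x ≢ y → All (_< h) u → Unique u →
  Below12 h u ⊎ HasDoubleDescent (h ∷ u)
two-below h (a ∷ []) x y (here refl) (here refl) x≢y _ _ = ⊥-elim (x≢y refl)
two-below h (a ∷ []) x y (here refl) (there ()) _ _ _
two-below h (a ∷ []) x y (there ()) _ _ _ _
two-below h (a ∷ b ∷ r) _ _ _ _ _ (a<h ∷ b<h ∷ _) ((a≢b ∷ _) ∷ _) with <-cmp a b
... | tri< a<b _ _ = inj₁ (here a<h (here (a<b , b<h)))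
... | tri≈ _ a≡b _ = ⊥-elim (a≢b a≡b)
... | tri> _ _ b<a = inj₂ (here a<h b<a)

no-two-smaller-later : ∀ p m h t → p < m → m < h → p ∈ t → m ∈ t →
  Unique (h ∷ t) → IsSimsun (h ∷ t) → ¬ Contains312 (h ∷ t) → ⊥
no-two-smaller-later p m h t p<m m<h p∈t m∈t (h∉t ∷ uniq) simsun no312
  with two-below h (restrict h t) p m
         (∈-filter⁺ (_≤? h) p∈t (≤-trans (<⇒≤ p<m) (<⇒≤ m<h))) (∈-filter⁺ (_≤? h) m∈t (<⇒≤ m<h))
         (λ p≡m → <-irrefl p≡m p<m) (restrict-below h t h∉t) (Unique.filter⁺ (_≤? h) uniq)
... | inj₁ b12 = no312 (below12⇒contains312 (below12-restrict h h t b12))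
... | inj₂ dd  = simsun h (subst HasDoubleDescent (sym (filter-accept (_≤? h) ≤-refl)) dd)

∈-tail : ∀ {x h : ℕ} {t} → x ∈ h ∷ t → x ≢ h → x ∈ t
∈-tail (here x≡h) x≢h = ⊥-elim (x≢h x≡h)
∈-tail (there x∈t) _  = x∈t

readOpenBlock : ∀ p m n σ → p ≤ m → σ ↭ p ∷ run (suc m) n → Unique σ → IsSimsun σ → ¬ Contains312 σ →
  ∃[ q ] ∃[ c ] (All (1 ≤_) c × q + sum c ≡ n × σ ≡ run (suc m) q ++ p ∷ rhoFrom (m + q) c)

readBlocks : ∀ s n σ → σ ↭ run (suc s) n → Unique σ → IsSimsun σ → ¬ Contains312 σ →
  ∃[ c ] (All (1 ≤_) c × sum c ≡ n × rhoFrom s c ≡ σ)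

readOpenBlock p m n [] _ σ↭ _ _ _ = ⊥-elim (¬x∷xs↭[] (↭-sym σ↭))
readOpenBlock p m n (h ∷ t) p≤m σ↭ (h∉t ∷ uniq) simsun no312 with h ≟ p
... | yes refl =
  let (c , pos , sum≡ , ρ≡t) = readBlocks m n t (drop-∷ σ↭) uniq (simsun-tail {h} simsun) (λ c → no312 (contains312-∷ c)) in
  0 , c , pos , sum≡ , cong (h ∷_) (sym (trans (cong (λ b → rhoFrom b c) (+-identityʳ m)) ρ≡t))
... | no h≢p with n | h ≟ suc m
...   | suc n′ | yes refl =
  let (q , c , pos , sum≡ , t≡) = readOpenBlock p (suc m) n′ t (<⇒≤ (s≤s p≤m))
         (drop-∷ (↭-trans σ↭ (swap p h ↭-refl))) uniq (simsun-tail {h} simsun) (λ c → no312 (contains312-∷ c))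
  in suc q , c , pos , cong suc sum≡
   , cong (h ∷_) (trans t≡ (cong (λ b → run (suc (suc m)) q ++ p ∷ rhoFrom b c) (sym (+-suc m q))))
...   | zero | _ with ∈-resp-↭ σ↭ (here refl)
...     | here h≡p = ⊥-elim (h≢p h≡p)
...     | there ()
readOpenBlock p m n (h ∷ t) p≤m σ↭ (h∉t ∷ uniq) simsun no312 | no h≢p | suc n′ | no h≢m+1
  with ∈-resp-↭ σ↭ (here refl)
...     | here h≡p = ⊥-elim (h≢p h≡p)
...     | there (here h≡m+1) = ⊥-elim (h≢m+1 h≡m+1)
...     | there (there h∈run) = ⊥-elim (no-two-smaller-later p (suc m) h t
  (s≤s p≤m) (run-lower (suc (suc m)) n′ h∈run)
  (∈-tail (∈-resp-↭ (↭-sym σ↭) (here refl)) (λ p≡h → h≢p (sym p≡h)))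
  (∈-tail (∈-resp-↭ (↭-sym σ↭) (there (here refl))) (λ m+1≡h → h≢m+1 (sym m+1≡h)))
  (h∉t ∷ uniq) simsun no312)

readBlocks s zero σ σ↭ _ _ _ with ↭-empty-inv σ↭
... | refl = [] , [] , refl , refl
readBlocks s (suc n) σ σ↭ uniq simsun no312 =
  let (q , c , pos , sum≡ , σ≡) = readOpenBlock (suc s) (suc s) n σ ≤-refl σ↭ uniq simsun no312 in
  suc q ∷ c , s≤s z≤n ∷ pos , cong suc sum≡ , trans (rhoFrom-suc s q c) (sym σ≡)

proposition4p6 : ∀ (n : ℕ) → n ≥ 1 →
    ((c : List ℕ) → IsComposition n c → RS312 n (rho c))
    × ((c c′ : List ℕ) → IsComposition n c → IsComposition n c′ → rho c ≡ rho c′ → c ≡ c′)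
    × ((σ : List ℕ) → RS312 n σ → ∃[ c ] (IsComposition n c × rho c ≡ σ))
proposition4p6 n _ = into , injective , onto
  where
  into : (c : List ℕ) → IsComposition n c → RS312 n (rho c)
  into c (_ , sum≡n) =
      subst (rho c ↭_) (trans (cong (run 1) sum≡n) (sym (oneToN-run n))) (rhoFrom-↭ 0 c)
    , rho-simsun c
    , (λ occurrence → rhoFrom-no312 0 c (contains312⇒has312 (rho c) occurrence))

  injective : (c c′ : List ℕ) → IsComposition n c → IsComposition n c′ → rho c ≡ rho c′ → c ≡ c′
  injective c c′ (pos , _) (pos′ , _) = rhoFrom-injective 0 c c′ pos pos′

  onto : (σ : List ℕ) → RS312 n σ → ∃[ c ] (IsComposition n c × rho c ≡ σ)
  onto σ (σ↭ , simsun , no312) =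
    let (c , pos , sum≡n , ρ≡σ) = readBlocks 0 n σ (subst (σ ↭_) (oneToN-run n) σ↭)
                                    (perm-unique n σ σ↭) simsun no312
    in c , (pos , sum≡n) , ρ≡σ
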